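{- Let $(Q,\rightarrow)$ be a finite transition system, $\mathscr{U}$ a preorder on $Q$, $\mathscr{R}$ a preorder with $\mathscr{R}\subseteq\mathscr{U}$ and $\mathscr{R}\circ\rightarrow^{ -1}\subseteq\rightarrow^{ -1}\circ\mathscr{U}$, $\mathscr{P}\subseteq\mathscr{R}$ an equivalence relation whose blocks have fixed representatives, and $\mathit{NotRel}=\mathscr{U}\setminus\mathscr{R}$. Then: 1. if $E\rightarrow B$ is a $(\mathscr{P},\mathscr{R})$-splitter transition of type 1, then $\mathit{NotRel}(B)\neq\emptyset$; 2. if there is no $(\mathscr{P},\mathscr{R})$-splitter transition of type 1 and $E\rightarrow B$ is a $(\mathscr{P},\mathscr{R})$-splitter transition of type 2, then $\mathit{NotRel}(B)\neq\emptyset$.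
   Context: Composition: $\mathscr{S}\circ\mathscr{R}=\{(x,y)\mid\exists z,(x,z)\in\mathscr{R},(z,y)\in\mathscr{S}\}$; $\mathscr{R}(X)=\{y\mid\exists x\in X,\ x\,\mathscr{R}\,y\}$; $\rightarrow^{ -1}(B)=\{q\mid\exists b\in B,\ q\rightarrow b\}$. Blocks of a preorder $\mathscr{R}$: $[q]_{\mathscr{R}}=\{q'\mid q\,\mathscr{R}\,q'\wedge q'\,\mathscr{R}\,q\}$. Each block $E$ of $\mathscr{P}$ has a fixed representative $E.\mathit{rep}\in E$. $X\,\mathscr{R}\,Y$ means $(X\times Y)\cap\mathscr{R}\ne\emptyset$; $X\rightarrow Y$ means some $x\in X,y\in Y$ with $x\rightarrow y$. $\mathrm{RelCount}_{(\mathscr{P},\mathscr{R})}(E,B)=|\{E'\text{ block of }\mathscr{P}\mid E.\mathit{rep}\rightarrow E'\wedge B\,\mathscr{R}\,E'\}|$. A splitter transition of type 1 is a pair $(E,B)$, $E$ a block of $\mathscr{P}$, $B$ a block of $\mathscr{R}$, with $E\rightarrow B$ and $\mathrm{RelCount}_{(\mathscr{P},\mathscr{R})}(E,B)=0$. A splitter transition of type 2 is a pair $(E,B)$, $E$ a block of $\mathscr{P}$, $B$ a block of $\mathscr{R}$, with $E.\mathit{rep}\rightarrow B$, $\mathrm{RelCount}_{(\mathscr{P},\mathscr{R})}(E,B)=|\{[b]_{\mathscr{P}}\subseteq B\mid E.\mathit{rep}\rightarrow b\}|$, and $E\not\subseteq\rightarrow^{ -1}(B)$. -}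

module Defs where

open import Level using (0ℓ)
open import Data.Nat using (ℕ; zero; suc)
open import Data.Fin using (Fin; zero; suc; _≟_)
open import Data.Fin.Properties using (any?; all?)
open import Data.Product using (Σ; ∃; ∃-syntax; _×_; _,_)
open import Relation.Nullary using (Dec; yes; no; ¬_)
open import Relation.Nullary.Decidable using (_×-dec_; _→-dec_)
open import Relation.Binary using (Rel; Decidable)
open import Relation.Binary.PropositionalEquality using (_≡_)

countFin : ∀ {n} {A : Fin n → Set} → (∀ i → Dec (A i)) → ℕ
countFin {zero} _ = 0
countFin {suc n} A? with A? zero
... | yes _ = suc (countFin (λ i → A? (suc i)))
... | no  _ = countFin (λ i → A? (suc i))

-- A block of P is
-- represented by any of its elements e (the block is [e]_P, its
-- representative is rep e); the blocks of P are in bijection with the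
-- fixed points of rep, which is how blocks of P are counted.
-- A block of R is represented by any of its elements b (B = [b]_R).
module Splitters {n : ℕ}
  (_⟶_ : Rel (Fin n) 0ℓ) (_⟶?_ : Decidable _⟶_)
  (R : Rel (Fin n) 0ℓ) (R? : Decidable R)
  (U : Rel (Fin n) 0ℓ)
  (P : Rel (Fin n) 0ℓ) (P? : Decidable P)
  (rep : Fin n → Fin n) where

  InRBlock : Fin n → Fin n → Set
  InRBlock b x = R b x × R x b

  InRBlock? : ∀ b x → Dec (InRBlock b x)
  InRBlock? b x = R? b x ×-dec R? x b

  BlockTrans : Fin n → Fin n → Set
  BlockTrans e b = ∃[ x ] ∃[ y ] (P e x × x ⟶ y × InRBlock b y)

  RepTrans : Fin n → Fin n → Set
  RepTrans e b = ∃[ y ] (rep e ⟶ y × InRBlock b y)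

  RelCountPred : Fin n → Fin n → Fin n → Set
  RelCountPred e b r =
    rep r ≡ r
    × (∃[ y ] (rep e ⟶ y × P r y))
    × (∃[ x ] ∃[ y ] (InRBlock b x × P r y × R x y))

  RelCountPred? : ∀ e b r → Dec (RelCountPred e b r)
  RelCountPred? e b r =
    (rep r ≟ r)
    ×-dec any? (λ y → (rep e ⟶? y) ×-dec P? r y)
    ×-dec any? (λ x → any? (λ y → InRBlock? b x ×-dec P? r y ×-dec R? x y))

  RelCount : Fin n → Fin n → ℕ
  RelCount e b = countFin (RelCountPred? e b)

  SuccBlockPred : Fin n → Fin n → Fin n → Set
  SuccBlockPred e b r =
    rep r ≡ r
    × (∀ y → P r y → InRBlock b y)
    × (∃[ y ] (P r y × rep e ⟶ y))

  SuccBlockPred? : ∀ e b r → Dec (SuccBlockPred e b r)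
  SuccBlockPred? e b r =
    (rep r ≟ r)
    ×-dec all? (λ y → P? r y →-dec InRBlock? b y)
    ×-dec any? (λ y → P? r y ×-dec (rep e ⟶? y))

  SuccBlockCount : Fin n → Fin n → ℕ
  SuccBlockCount e b = countFin (SuccBlockPred? e b)

  BlockInPre : Fin n → Fin n → Set
  BlockInPre e b = ∀ x → P e x → ∃[ y ] (x ⟶ y × InRBlock b y)

  SplitterType1 : Fin n → Fin n → Set
  SplitterType1 e b = BlockTrans e b × RelCount e b ≡ 0

  SplitterType2 : Fin n → Fin n → Set
  SplitterType2 e b =
    RepTrans e b × RelCount e b ≡ SuccBlockCount e b × ¬ BlockInPre e b

  NotRelNonEmpty : Fin n → Set
  NotRelNonEmpty b = ∃[ x ] ∃[ y ] (InRBlock b x × U x y × ¬ R x y)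

-- A transition x → y leaving the
-- P-block E of e is transferred, by the simulation hypothesis
-- R ∘ →⁻¹ ⊆ →⁻¹ ∘ U, to a transition E.rep → w with y U w.  It then
-- suffices to refute y R w using the counting hypothesis of the splitter;
-- this gives (y , w) ∈ U \ R with y ∈ B.
--   * Type 1: y R w would make the P-block of w counted by RelCount(E,B) = 0.
--   * Type 2: with the roles of E.rep and x ∈ E swapped (x has no transition
--     into B), w R-related to B would, since (E,[w]_R) is not a type-1
--     splitter and RelCount(E,B) equals the number of successor blocks of
--     E.rep inside B, force w ∈ B — contradicting the choice of x.
module Submission where

open import Defs
open import Level using (0ℓ)
open import Data.Nat using (ℕ; zero; suc; _≤_; z≤n; s≤s)
open import Data.Nat.Properties using (m≤n⇒m≤1+n; 1+n≰n; suc-injective)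
open import Data.Fin using (Fin; zero; suc)
open import Data.Fin.Properties using (any?)
open import Data.Product using (∃-syntax; _×_; _,_; proj₁; proj₂)
open import Data.Empty using (⊥-elim)
open import Relation.Nullary using (Dec; yes; no; ¬_)
open import Relation.Nullary.Decidable using (_×-dec_; ¬?; decidable-stable)
open import Relation.Binary using (Rel; Decidable; IsPreorder; IsEquivalence)
open import Relation.Binary.PropositionalEquality using (_≡_; refl; sym; subst)

countFin-mono : ∀ {n} {A B : Fin n → Set}
  (A? : ∀ i → Dec (A i)) (B? : ∀ i → Dec (B i)) →
  (∀ i → A i → B i) → countFin A? ≤ countFin B?
countFin-mono {zero} A? B? A⊆B = z≤n
countFin-mono {suc n} A? B? A⊆B with A? zero | B? zero
... | yes _ | yes _  = s≤s (countFin-mono (λ i → A? (suc i)) (λ i → B? (suc i)) (λ i → A⊆B (suc i)))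
... | yes a | no ¬b  = ⊥-elim (¬b (A⊆B zero a))
... | no _  | yes _  = m≤n⇒m≤1+n (countFin-mono (λ i → A? (suc i)) (λ i → B? (suc i)) (λ i → A⊆B (suc i)))
... | no _  | no _   = countFin-mono (λ i → A? (suc i)) (λ i → B? (suc i)) (λ i → A⊆B (suc i))

countFin-≡⇒⊇ : ∀ {n} {A B : Fin n → Set}
  (A? : ∀ i → Dec (A i)) (B? : ∀ i → Dec (B i)) →
  (∀ i → A i → B i) → countFin A? ≡ countFin B? → ∀ i → B i → A i
countFin-≡⇒⊇ {suc n} A? B? A⊆B eq i Bi with A? zero | B? zero
countFin-≡⇒⊇ {suc n} A? B? A⊆B eq zero Bi | yes a | _ = a
countFin-≡⇒⊇ {suc n} A? B? A⊆B eq (suc i) Bi | yes _ | yes _ =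
  countFin-≡⇒⊇ (λ j → A? (suc j)) (λ j → B? (suc j)) (λ j → A⊆B (suc j)) (suc-injective eq) i Bi
countFin-≡⇒⊇ {suc n} A? B? A⊆B eq (suc i) Bi | yes a | no ¬b = ⊥-elim (¬b (A⊆B zero a))
countFin-≡⇒⊇ {suc n} A? B? A⊆B eq i Bi | no _ | yes _ =
  ⊥-elim (1+n≰n (subst (_≤ _) eq
    (countFin-mono (λ j → A? (suc j)) (λ j → B? (suc j)) (λ j → A⊆B (suc j)))))
countFin-≡⇒⊇ {suc n} A? B? A⊆B eq zero Bi | no _ | no ¬b = ⊥-elim (¬b Bi)
countFin-≡⇒⊇ {suc n} A? B? A⊆B eq (suc i) Bi | no _ | no _ =
  countFin-≡⇒⊇ (λ j → A? (suc j)) (λ j → B? (suc j)) (λ j → A⊆B (suc j)) eq i Bi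

countFin-zero : ∀ {n} {A : Fin n → Set} (A? : ∀ i → Dec (A i)) →
  countFin A? ≡ 0 → ∀ i → ¬ A i
countFin-zero {suc n} A? eq i Ai with A? zero
countFin-zero {suc n} A? () i Ai | yes _
countFin-zero {suc n} A? eq zero Ai | no ¬a = ¬a Ai
countFin-zero {suc n} A? eq (suc i) Ai | no _ = countFin-zero (λ j → A? (suc j)) eq i Ai

countFin-witness : ∀ {n} {A : Fin n → Set} (A? : ∀ i → Dec (A i)) →
  ¬ countFin A? ≡ 0 → ∃[ i ] A i
countFin-witness {zero} A? ≢0 = ⊥-elim (≢0 refl)
countFin-witness {suc n} A? ≢0 with A? zero
... | yes a = zero , a
... | no _ with countFin-witness (λ i → A? (suc i)) ≢0
...   | i , a = suc i , a

module SplitterWitnesses {n : ℕ}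
  (_⟶_ : Rel (Fin n) 0ℓ) (_⟶?_ : Decidable _⟶_)
  (U : Rel (Fin n) 0ℓ)
  (R : Rel (Fin n) 0ℓ) (R? : Decidable R) (R-preorder : IsPreorder _≡_ R)
  (simulation : ∀ x y z → z ⟶ x → R z y → ∃[ w ] (U x w × y ⟶ w))
  (P : Rel (Fin n) 0ℓ) (P? : Decidable P) (P-equivalence : IsEquivalence P)
  (P⊆R : ∀ x y → P x y → R x y)
  (rep : Fin n → Fin n)
  (rep-in-block : ∀ q → P q (rep q))
  (rep-cong : ∀ q q′ → P q q′ → rep q ≡ rep q′)
  where

  open Splitters _⟶_ _⟶?_ R R? U P P? rep
  open IsEquivalence P-equivalence using () renaming (sym to P-sym; trans to P-trans)

  R-trans : ∀ {x y z} → R x y → R y z → R x z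
  R-trans = IsPreorder.trans R-preorder

  R-refl : ∀ {x} → R x x
  R-refl = IsPreorder.reflexive R-preorder refl

  Into : Fin n → Fin n → Set
  Into b x = ∃[ y ] (x ⟶ y × InRBlock b y)

  Into? : ∀ b x → Dec (Into b x)
  Into? b x = any? (λ y → (x ⟶? y) ×-dec InRBlock? b y)

  rep-P : ∀ {e x} → P e x → P (rep e) x
  rep-P {e} Pex = P-trans (P-sym (rep-in-block e)) Pex

  rep-idempotent : ∀ q → rep (rep q) ≡ rep q
  rep-idempotent q = sym (rep-cong q (rep q) (rep-in-block q))

  counted : ∀ {e b y w} → rep e ⟶ w → InRBlock b y → R y w → RelCountPred e b (rep w)
  counted {w = w} rep⟶w y∈B Ryw =
    rep-idempotent w , (w , rep⟶w , P-sym (rep-in-block w)) , (_ , w , y∈B , P-sym (rep-in-block w) , Ryw)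

  successor⇒counted : ∀ e b r → SuccBlockPred e b r → RelCountPred e b r
  successor⇒counted e b r (fixed , inside , (y , Pry , rep⟶y)) =
    fixed , (y , rep⟶y , Pry) , (y , y , inside y Pry , Pry , R-refl)

  escaping-member : ∀ {e b} → ¬ BlockInPre e b → ∃[ x ] (P e x × ¬ Into b x)
  escaping-member {e} {b} ¬E⊆pre with any? (λ x → P? e x ×-dec ¬? (Into? b x))
  ... | yes found = found
  ... | no none = ⊥-elim (¬E⊆pre λ x Pex →
          decidable-stable (Into? b x) (λ ¬into → none (x , Pex , ¬into)))

  type1-witness : ∀ e b → SplitterType1 e b → NotRelNonEmpty b
  type1-witness e b ((x , y , Pex , x⟶y , y∈B) , count≡0)
    with simulation y (rep e) x x⟶y (P⊆R x (rep e) (P-sym (rep-P Pex)))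
  ... | w , Uyw , rep⟶w with R? y w
  ...   | no ¬Ryw = y , w , y∈B , Uyw , ¬Ryw
  ...   | yes Ryw = ⊥-elim (countFin-zero (RelCountPred? e b) count≡0 (rep w) (counted rep⟶w y∈B Ryw))

  related-successor : (∀ e b → ¬ SplitterType1 e b) →
    ∀ {e x w} → P e x → x ⟶ w → ∃[ r ] RelCountPred e w r
  related-successor noType1 {e} {x} {w} Pex x⟶w =
    countFin-witness (RelCountPred? e w)
      (λ count≡0 → noType1 e w ((x , w , Pex , x⟶w , R-refl , R-refl) , count≡0))

  counted⇒inside : ∀ {e b} → RelCount e b ≡ SuccBlockCount e b →
    ∀ r y → RelCountPred e b r → P r y → InRBlock b y
  counted⇒inside {e} {b} counts r y counted-r Pry =
    proj₁ (proj₂ (countFin-≡⇒⊇ (SuccBlockPred? e b) (RelCountPred? e b)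
      (successor⇒counted e b) (sym counts) r counted-r)) y Pry

  type2-witness : (∀ e b → ¬ SplitterType1 e b) →
    ∀ e b → SplitterType2 e b → NotRelNonEmpty b
  type2-witness noType1 e b ((y₀ , rep⟶y₀ , y₀∈B) , counts , ¬E⊆pre)
    with escaping-member ¬E⊆pre
  ... | x , Pex , ¬into with simulation y₀ x (rep e) rep⟶y₀ (P⊆R (rep e) x (rep-P Pex))
  ...   | w , Uy₀w , x⟶w with R? y₀ w
  ...     | no ¬Ry₀w = y₀ , w , y₀∈B , Uy₀w , ¬Ry₀w
  ...     | yes Ry₀w = ⊥-elim (¬into (w , x⟶w , w∈B))
    where
    -- [w]_R is related to a successor block [r]_P of E.rep, via w R x′ R y′;
    -- then B R [r]_P through y₀ R w, so [r]_P ⊆ B and hence w ∈ B.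
    w∈B : InRBlock b w
    w∈B with related-successor noType1 Pex x⟶w
    ... | r , fixed , succ , (x′ , y′ , (Rwx′ , Rx′w) , Pry′ , Rx′y′) =
      R-trans (proj₁ y₀∈B) Ry₀w , R-trans Rwx′ (R-trans Rx′y′ (proj₂ y′∈B))
      where
      y′∈B : InRBlock b y′
      y′∈B = counted⇒inside counts r y′
        (fixed , succ , (y₀ , y′ , y₀∈B , Pry′ , R-trans Ry₀w (R-trans Rwx′ Rx′y′))) Pry′

proposition5 : {n : ℕ}
    (_⟶_ : Rel (Fin n) 0ℓ) (_⟶?_ : Decidable _⟶_)
    (U : Rel (Fin n) 0ℓ) → IsPreorder _≡_ U →
    (R : Rel (Fin n) 0ℓ) (R? : Decidable R) → IsPreorder _≡_ R →
    (∀ x y → R x y → U x y) →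
    (∀ x y z → z ⟶ x → R z y → ∃[ w ] (U x w × y ⟶ w)) →
    (P : Rel (Fin n) 0ℓ) (P? : Decidable P) → IsEquivalence P →
    (∀ x y → P x y → R x y) →
    (rep : Fin n → Fin n) →
    (∀ q → P q (rep q)) →
    (∀ q q′ → P q q′ → rep q ≡ rep q′) →
    let open Splitters _⟶_ _⟶?_ R R? U P P? rep in
    (∀ e b → SplitterType1 e b → NotRelNonEmpty b)
    × ((∀ e b → ¬ SplitterType1 e b) →
    ∀ e b → SplitterType2 e b → NotRelNonEmpty b)
proposition5 _⟶_ _⟶?_ U _ R R? R-preorder _ simulation P P? P-equivalence P⊆R rep rep-in-block rep-cong =
  type1-witness , type2-witness
  where
  open SplitterWitnesses _⟶_ _⟶?_ U R R? R-preorder simulation P P? P-equivalence P⊆R rep rep-in-block rep-cong
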